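{- Let $G$ be a binary quasigroup of order $n$ and let $\mathcal Y_1^i,\dots,\mathcal Y_{\tau_i}^i$ be the units of an equivalence class $\mathcal U_i$. Then there is a number $r_i$ such that for all tuples $V\in\mathcal I_n^n$, all $j\in\mathcal I_n$ and all $k$, the unit $\mathcal Y_k^i$ contains exactly $r_i$ tuples from the set $V_j^*$.
   Context: Let $\mathcal I_n=\{1,\dots,n\}$. A binary quasigroup $G$ of order $n$ is the set $\mathcal I_n$ with an operation $*$ such that for all $a_0,a_1,a_2$ there are unique $x_1,x_2$ with $a_1*x_2=a_0$ and $x_1*a_2=a_0$. Elements of $\mathcal I_n^n$ are tuples; $*$ acts on tuples entrywise. A permutation is a tuple with pairwise distinct entries; $\mathcal W$ is the set of permutations. For $d\ge0$, a $U$-diagonal of type $V$ in $G[d]$ is a sequence $(W_1,\dots,W_d)\in\mathcal W^d$ with $(\cdots((U*W_1)*W_2)*\cdots)*W_d=V$ entrywise. Tuples $U,V$ are equivalent if for some $d\ge0$ there is a $U$-diagonal of type $V$ in $G[d]$; the classes are the equivalence classes. The period $\tau$ of a class $\mathcal U$ is the gcd of all $d\ge1$ such that some $U\in\mathcal U$ admits a $U$-diagonal of type $U$ in $G[d]$. A class of period $\tau$ is partitioned into $\tau$ sets $\mathcal Y_1,\dots,\mathcal Y_\tau$, called units, such that for $U\in\mathcal Y_k$, $V\in\mathcal Y_l$ a $U$-diagonal of type $V$ in $G[d]$ exists only if $l-k\equiv d\pmod\tau$. For a tuple $V$ and $b,j\in\mathcal I_n$, $V_j(b)$ is the tuple equal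 to $V$ except that its $j$-th entry is $b$, and $V_j^*=\{V_j(1),\dots,V_j(n)\}$. -}

module Defs where

open import Data.Nat using (ℕ; zero; suc; _≤_)
open import Data.Nat.Divisibility using (_∣_)
open import Data.Fin using (Fin; toℕ)
open import Data.Vec using (Vec; lookup; zipWith; _[_]≔_; foldl; allFin)
import Data.Vec as Vec
open import Data.Vec.Relation.Unary.All using (All)
open import Data.Bool using (Bool; true; false; if_then_else_)
open import Data.Product using (Σ; ∃; ∃-syntax; _×_; ∃!)
open import Data.Integer as ℤ using (ℤ; +_)
import Data.Integer.Divisibility as ℤD
open import Relation.Binary.PropositionalEquality using (_≡_)

-- Elements of I_n are represented by Fin n (0-based).
Op : ℕ → Set
Op n = Fin n → Fin n → Fin n

IsQuasigroup : ∀ {n} → Op n → Set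
IsQuasigroup {n} _*_ =
  (∀ (a₀ a₁ : Fin n) → ∃! _≡_ (λ x₂ → a₁ * x₂ ≡ a₀)) ×
  (∀ (a₀ a₂ : Fin n) → ∃! _≡_ (λ x₁ → x₁ * a₂ ≡ a₀))

Tuple : ℕ → Set
Tuple n = Vec (Fin n) n

_⊛_ : ∀ {n} → Op n → Tuple n → Tuple n → Tuple n
(_*_ ⊛ U) W = zipWith _*_ U W

IsPerm : ∀ {n} → Tuple n → Set
IsPerm {n} W = ∀ (i j : Fin n) → lookup W i ≡ lookup W j → i ≡ j

applyDiag : ∀ {n d} → Op n → Tuple n → Vec (Tuple n) d → Tuple n
applyDiag _*_ U Ws = foldl _ (λ acc W → (_*_ ⊛ acc) W) U Ws

HasDiag : ∀ {n} → Op n → Tuple n → Tuple n → ℕ → Set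
HasDiag {n} _*_ U V d =
  Σ (Vec (Tuple n) d) λ Ws → All IsPerm Ws × applyDiag _*_ U Ws ≡ V

Equiv : ∀ {n} → Op n → Tuple n → Tuple n → Set
Equiv _*_ U V = ∃[ d ] HasDiag _*_ U V d

InClass : ∀ {n} → Op n → Tuple n → Tuple n → Set
InClass _*_ U₀ V = Equiv _*_ U₀ V

CycleLength : ∀ {n} → Op n → Tuple n → ℕ → Set
CycleLength _*_ U₀ d = 1 ≤ d × ∃[ U ] (InClass _*_ U₀ U × HasDiag _*_ U U d)

IsPeriod : ∀ {n} → Op n → Tuple n → ℕ → Set
IsPeriod _*_ U₀ τ =
  (∀ d → CycleLength _*_ U₀ d → τ ∣ d) ×
  (∀ m → (∀ d → CycleLength _*_ U₀ d → m ∣ d) → m ∣ τ)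

-- Y k V ≡ true means V ∈ 𝒴_(k+1).  Units: a partition of the class into
-- τ nonempty sets with the congruence property of diagonals.
IsUnits : ∀ {n} → Op n → Tuple n → (τ : ℕ) → (Fin τ → Tuple n → Bool) → Set
IsUnits {n} _*_ U₀ τ Y =
  (∀ k V → Y k V ≡ true → InClass _*_ U₀ V) ×
  (∀ V → InClass _*_ U₀ V → ∃! _≡_ (λ k → Y k V ≡ true)) ×
  (∀ k → ∃[ V ] (Y k V ≡ true)) ×
  (∀ k l U V d → Y k U ≡ true → Y l V ≡ true → HasDiag _*_ U V d →
     (+ τ) ℤD.∣ ((+ toℕ l ℤ.- + toℕ k) ℤ.- + d))

countIn : ∀ {n} → (Tuple n → Bool) → Tuple n → Fin n → ℕ
countIn {n} Y V j =
  Vec.sum (Vec.map (λ b → if Y (V [ j ]≔ b) then 1 else 0) (allFin n))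

-- Write X ⊙ W for entrywise right multiplication. For a permutation W, X ↦ X ⊙ W
-- sends each unit into the cyclically next one (the congruence condition for d = 1;
-- going back uses that X ↦ X ⊙ W has finite order). Since b ↦ b * W_j is a bijection,
-- the number of b with V[j ≔ b] in a unit equals the number of c with (V ⊙ W)[j ≔ c]
-- in the next unit. Comparing two permutations that differ by the transposition (i j),
-- chosen by left division so that V_i * W_i ≡ t * W_j, shows that replacing V_i by t
-- (i ≢ j) does not change the count. So the count is independent of V, hence of the
-- unit, and by double counting over two coordinates also of j.
module Submission where

open import Defs
open import Data.Nat as ℕ using (ℕ; zero; suc; _<_)
import Data.Nat.Properties as ℕ
open import Data.Nat.Divisibility using (_∣_; _∣0; >⇒∤)
open import Data.Nat.GeneralisedArithmetic using (fold; iterate; fold-+; iterate-is-fold)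
open import Data.Integer as ℤ using (ℤ; +_; 0ℤ; 1ℤ)
import Data.Integer.Properties as ℤ
import Data.Integer.Divisibility as ℤ
open import Data.Integer.Divisibility.Signed using (∣ᵤ⇒∣; ∣⇒∣ᵤ; ∣m∣n⇒∣m-n)
open import Data.Integer.Tactic.RingSolver using (solve-∀)
open import Data.Fin using (Fin; zero; suc; toℕ; fromℕ<; funToFin; finToFun)
open import Data.Fin.Properties
  using (_≟_; pigeonhole; toℕ-injective; toℕ<n; toℕ-fromℕ<; fromℕ<-toℕ; finToFun-funToFin)
open import Data.Fin.Permutation
  using (Permutation′; permutation; _⟨$⟩ʳ_; _⟨$⟩ˡ_; inverseˡ; id; transpose; _∘ₚ_)
open import Data.Vec using (Vec; []; _∷_; lookup; tabulate; replicate; _[_]≔_; _++_)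
import Data.Vec as Vec
open import Data.Vec.Properties
  using (lookup-zipWith; lookup∘tabulate; tabulate-allFin; lookup∘update; lookup∘update′;
         []≔-lookup; []≔-commutes)
open import Data.Vec.Relation.Binary.Pointwise.Extensional using (ext; Pointwise-≡⇒≡)
open import Data.Vec.Relation.Unary.All using (All; []; _∷_)
open import Data.Vec.Relation.Unary.All.Properties using (++⁺)
open import Data.Bool using (Bool; true; if_then_else_)
open import Data.Bool.Properties using (⇔→≡)
open import Data.Product using (_,_; proj₁; proj₂; ∃-syntax)
open import Function using (_∘_; mk⇔)
open import Function.Definitions using (Injective)
open import Algebra.Properties.CommutativeMonoid.Sum ℕ.+-0-commutativeMonoid
  using (sum; sum-syntax; sum-cong-≗; sum-permute; ∑-comm)
open import Relation.Nullary using (yes; no; contradiction)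
open import Relation.Nullary.Decidable using (dec-true; dec-false)
open import Relation.Binary.PropositionalEquality
open ≡-Reasoning

lookup-ext : ∀ {A : Set} {n} {xs ys : Vec A n} → (∀ i → lookup xs i ≡ lookup ys i) → xs ≡ ys
lookup-ext = Pointwise-≡⇒≡ ∘ ext

update-invariant⇒constant : ∀ {A B : Set} {n} (f : Vec A n → B) →
  (∀ xs i x → f (xs [ i ]≔ x) ≡ f xs) → ∀ xs ys → f xs ≡ f ys
update-invariant⇒constant f invariant [] [] = refl
update-invariant⇒constant f invariant (x ∷ xs) (y ∷ ys) = begin
  f (x ∷ xs) ≡⟨ invariant (x ∷ xs) zero y ⟨
  f (y ∷ xs) ≡⟨ update-invariant⇒constant (f ∘ (y ∷_)) (λ zs i → invariant (y ∷ zs) (suc i)) xs ys ⟩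
  f (y ∷ ys) ∎

fold-injective : ∀ {A : Set} {f : A → A} → Injective _≡_ _≡_ f →
  ∀ m {x y} → fold x f m ≡ fold y f m → x ≡ y
fold-injective f-inj zero    eq = eq
fold-injective f-inj (suc m) eq = fold-injective f-inj m (f-inj eq)

-- By pigeonhole two iterates coincide; injectivity cancels the common prefix.
injective⇒iterate-returns : ∀ {A : Set} {N} (code : A → Fin N) → Injective _≡_ _≡_ code →
  (f : A → A) → Injective _≡_ _≡_ f → ∀ x → ∃[ d ] iterate f (f x) d ≡ x
injective⇒iterate-returns {N = N} code code-inj f f-inj x
  with pigeonhole (ℕ.n<1+n N) (λ i → code (fold x f (toℕ i)))
... | i , j , i<j , same with ℕ.m≤n⇒∃[o]m+o≡n i<j
... | d , i+1+d≡j = d , trans (sym (iterate-is-fold x f (suc d))) (fold-injective f-inj (toℕ i) (begin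
  fold (fold x f (suc d)) f (toℕ i) ≡⟨ fold-+ x f (toℕ i) ⟨
  fold x f (toℕ i ℕ.+ suc d)         ≡⟨ cong (fold x f) (trans (ℕ.+-suc (toℕ i) d) i+1+d≡j) ⟩
  fold x f (toℕ j)                   ≡⟨ code-inj same ⟨
  fold x f (toℕ i)                   ∎))

tuple-code-injective : ∀ {n} → Injective _≡_ _≡_ (λ (V : Tuple n) → funToFin (lookup V))
tuple-code-injective {x = V} {V′} eq = lookup-ext λ i → begin
  lookup V i                         ≡⟨ finToFun-funToFin (lookup V) i ⟨
  finToFun (funToFin (lookup V)) i   ≡⟨ cong (λ c → finToFun c i) eq ⟩
  finToFun (funToFin (lookup V′)) i  ≡⟨ finToFun-funToFin (lookup V′) i ⟩
  lookup V′ i                        ∎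

∑-const : ∀ n r → ∑[ _ < n ] r ≡ n ℕ.* r
∑-const zero    r = refl
∑-const (suc n) r = cong (r ℕ.+_) (∑-const n r)

sum-tabulate : ∀ {n} (h : Fin n → ℕ) → Vec.sum (tabulate h) ≡ sum h
sum-tabulate {zero}  h = refl
sum-tabulate {suc n} h = cong (h zero ℕ.+_) (sum-tabulate (h ∘ suc))

𝟙 : Bool → ℕ
𝟙 b = if b then 1 else 0

countIn-as-∑ : ∀ {n} (Z : Tuple n → Bool) V j → countIn Z V j ≡ ∑[ b < n ] 𝟙 (Z (V [ j ]≔ b))
countIn-as-∑ Z V j = trans (cong Vec.sum (sym (tabulate-allFin indicator))) (sum-tabulate indicator)
  where indicator = λ b → 𝟙 (Z (V [ j ]≔ b))

countIn-local : ∀ {n} (Z : Tuple n → Bool) {V V′ j} → (∀ i → i ≢ j → lookup V i ≡ lookup V′ i) →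
  countIn Z V j ≡ countIn Z V′ j
countIn-local Z {V} {V′} {j} agree = begin
  countIn Z V j                          ≡⟨ countIn-as-∑ Z V j ⟩
  ∑[ b < _ ] 𝟙 (Z (V [ j ]≔ b))          ≡⟨ sum-cong-≗ (λ b → cong (𝟙 ∘ Z) (lookup-ext (agree-updated b))) ⟩
  ∑[ b < _ ] 𝟙 (Z (V′ [ j ]≔ b))         ≡⟨ countIn-as-∑ Z V′ j ⟨
  countIn Z V′ j                         ∎
  where
  agree-updated : ∀ b i → lookup (V [ j ]≔ b) i ≡ lookup (V′ [ j ]≔ b) i
  agree-updated b i with i ≟ j
  ... | yes refl = trans (lookup∘update i V b) (sym (lookup∘update i V′ b))
  ... | no i≢j   = trans (lookup∘update′ i≢j V b) (trans (agree i i≢j) (sym (lookup∘update′ i≢j V′ b)))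

-- Double counting the tuples V[j ≔ b][j′ ≔ c] in Z.
countIn-index-independent : ∀ {n} (Z : Tuple (suc n) → Bool) →
  (∀ V V′ j → countIn Z V j ≡ countIn Z V′ j) → ∀ V j j′ → countIn Z V j ≡ countIn Z V j′
countIn-index-independent {n} Z independent V j j′ with j ≟ j′
... | yes refl = refl
... | no j≢j′  = ℕ.*-cancelˡ-≡ _ _ (suc n) (begin
  suc n ℕ.* countIn Z V j                          ≡⟨ ∑-const (suc n) _ ⟨
  ∑[ c < suc n ] countIn Z V j                     ≡⟨ sum-cong-≗ (λ c → independent V (V [ j′ ]≔ c) j) ⟩
  ∑[ c < suc n ] countIn Z (V [ j′ ]≔ c) j         ≡⟨ sum-cong-≗ (λ c → countIn-as-∑ Z (V [ j′ ]≔ c) j) ⟩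
  ∑[ c < suc n ] ∑[ b < suc n ] 𝟙 (Z ((V [ j′ ]≔ c) [ j ]≔ b))
    ≡⟨ sum-cong-≗ (λ c → sum-cong-≗ (λ b → cong (𝟙 ∘ Z) ([]≔-commutes {x = c} {y = b} V j′ j (j≢j′ ∘ sym)))) ⟩
  ∑[ c < suc n ] ∑[ b < suc n ] 𝟙 (Z ((V [ j ]≔ b) [ j′ ]≔ c))
    ≡⟨ ∑-comm (λ c b → 𝟙 (Z ((V [ j ]≔ b) [ j′ ]≔ c))) ⟩
  ∑[ b < suc n ] ∑[ c < suc n ] 𝟙 (Z ((V [ j ]≔ b) [ j′ ]≔ c))
    ≡⟨ sum-cong-≗ (λ b → countIn-as-∑ Z (V [ j ]≔ b) j′) ⟨
  ∑[ b < suc n ] countIn Z (V [ j ]≔ b) j′         ≡⟨ sum-cong-≗ (λ b → independent (V [ j ]≔ b) V j′) ⟩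
  ∑[ b < suc n ] countIn Z V j′                    ≡⟨ ∑-const (suc n) _ ⟩
  suc n ℕ.* countIn Z V j′                         ∎)

∣[m-n]⇒m≡n : ∀ {τ m n} → m < τ → n < τ → (+ τ) ℤ.∣ (+ m ℤ.- + n) → m ≡ n
∣[m-n]⇒m≡n {τ} {m} {n} m<τ n<τ τ∣m-n =
  ℤ.+-injective (ℤ.i-j≡0⇒i≡j _ _ (ℤ.∣i∣≡0⇒i≡0 (smaller-multiple≡0 τ∣m-n distance<τ)))
  where
  distance<τ : ℤ.∣ + m ℤ.- + n ∣ < τ
  distance<τ = subst (_< τ) (cong ℤ.∣_∣ (sym (ℤ.m-n≡m⊖n m n)))
                     (ℕ.≤-<-trans (ℤ.∣m⊝n∣≤m⊔n m n) (ℕ.⊔-lub m<τ n<τ))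
  smaller-multiple≡0 : ∀ {d} → τ ∣ d → d < τ → d ≡ 0
  smaller-multiple≡0 {zero}  _   _   = refl
  smaller-multiple≡0 {suc d} τ∣d d<τ = contradiction τ∣d (>⇒∤ d<τ)

module _ {τ : ℕ} where

  offset : Fin τ → Fin τ → ℤ
  offset k l = (+ toℕ l ℤ.- + toℕ k) ℤ.- 1ℤ

  -- The congruence condition of IsUnits for diagonals of length 1.
  record Next (k l : Fin τ) : Set where
    constructor next
    field τ∣offset : (+ τ) ℤ.∣ offset k l

  ∣offset-difference : ∀ {k l k′ l′} → Next k l → Next k′ l′ → (+ τ) ℤ.∣ (offset k l ℤ.- offset k′ l′)
  ∣offset-difference {k} {l} {k′} {l′} (next τ∣kl) (next τ∣k′l′) =
    ∣⇒∣ᵤ (∣m∣n⇒∣m-n (∣ᵤ⇒∣ {+ τ} {offset k l} τ∣kl) (∣ᵤ⇒∣ {+ τ} {offset k′ l′} τ∣k′l′))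

  Next-functional : ∀ {k l l′} → Next k l → Next k l′ → l ≡ l′
  Next-functional {k} {l} {l′} k↝l k↝l′ = toℕ-injective (∣[m-n]⇒m≡n (toℕ<n l) (toℕ<n l′)
    (subst (ℤ._∣_ (+ τ)) (difference (+ toℕ l) (+ toℕ l′) (+ toℕ k))
      (∣offset-difference k↝l k↝l′)))
    where
    difference : ∀ x y z → ((x ℤ.- z) ℤ.- 1ℤ) ℤ.- ((y ℤ.- z) ℤ.- 1ℤ) ≡ x ℤ.- y
    difference = solve-∀

  Next-injective : ∀ {k k′ l} → Next k l → Next k′ l → k ≡ k′
  Next-injective {k} {k′} {l} k↝l k′↝l = toℕ-injective (∣[m-n]⇒m≡n (toℕ<n k) (toℕ<n k′)
    (subst (ℤ._∣_ (+ τ)) (difference (+ toℕ k) (+ toℕ k′) (+ toℕ l))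
      (∣offset-difference k′↝l k↝l)))
    where
    difference : ∀ x y z → ((z ℤ.- y) ℤ.- 1ℤ) ℤ.- ((z ℤ.- x) ℤ.- 1ℤ) ≡ x ℤ.- y
    difference = solve-∀

  Next-suc : ∀ {k l} → toℕ l ≡ suc (toℕ k) → Next k l
  Next-suc {k} {l} l≡1+k = next (subst (λ z → τ ∣ ℤ.∣ z ∣) (sym zero-difference) (τ ∣0))
    where
    cancel : ∀ x → ((1ℤ ℤ.+ x) ℤ.- x) ℤ.- 1ℤ ≡ 0ℤ
    cancel = solve-∀
    zero-difference : (+ toℕ l ℤ.- + toℕ k) ℤ.- 1ℤ ≡ 0ℤ
    zero-difference rewrite l≡1+k = cancel (+ toℕ k)

permutation-tuple : ∀ {n} → Permutation′ n → Tuple n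
permutation-tuple π = tabulate (π ⟨$⟩ʳ_)

permutation-tuple-isPerm : ∀ {n} (π : Permutation′ n) → IsPerm (permutation-tuple π)
permutation-tuple-isPerm π i j eq = begin
  i                       ≡⟨ inverseˡ π ⟨
  π ⟨$⟩ˡ (π ⟨$⟩ʳ i)        ≡⟨ cong (π ⟨$⟩ˡ_) (trans (sym (lookup∘tabulate _ i)) (trans eq (lookup∘tabulate _ j))) ⟩
  π ⟨$⟩ˡ (π ⟨$⟩ʳ j)        ≡⟨ inverseˡ π ⟩
  j                       ∎

transpose-matchˡ : ∀ {n} (i j : Fin n) → transpose i j ⟨$⟩ʳ i ≡ j
transpose-matchˡ i j rewrite dec-true (i ≟ i) refl = refl

transpose-fixes : ∀ {n} {i j k : Fin n} → k ≢ i → k ≢ j → transpose i j ⟨$⟩ʳ k ≡ k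
transpose-fixes {i = i} {j} {k} k≢i k≢j rewrite dec-false (k ≟ i) k≢i | dec-false (k ≟ j) k≢j = refl

applyDiag-++ : ∀ {n d e} (_*_ : Op n) (Ws : Vec (Tuple n) d) (Ws′ : Vec (Tuple n) e) X →
  applyDiag _*_ X (Ws ++ Ws′) ≡ applyDiag _*_ (applyDiag _*_ X Ws) Ws′
applyDiag-++ _*_ []       Ws′ X = refl
applyDiag-++ _*_ (W ∷ Ws) Ws′ X = applyDiag-++ _*_ Ws Ws′ ((_*_ ⊛ X) W)

Equiv-trans : ∀ {n} {_*_ : Op n} {U V X} → Equiv _*_ U V → Equiv _*_ V X → Equiv _*_ U X
Equiv-trans {_*_ = _*_} {U} (d , Ws , Ws-perm , refl) (e , Ws′ , Ws′-perm , refl) =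
  d ℕ.+ e , Ws ++ Ws′ , ++⁺ Ws-perm Ws′-perm , applyDiag-++ _*_ Ws Ws′ U

module Quasigroup {n} {_*_ : Op n} (isQuasigroup : IsQuasigroup _*_) where

  infixl 7 _⊙_
  _⊙_ : Tuple n → Tuple n → Tuple n
  X ⊙ W = (_*_ ⊛ X) W

  lookup-⊙ : ∀ X W i → lookup (X ⊙ W) i ≡ lookup X i * lookup W i
  lookup-⊙ X W i = lookup-zipWith _*_ i X W

  *-cancelʳ : ∀ {w x y} → x * w ≡ y * w → x ≡ y
  *-cancelʳ {w} {x} {y} eq with proj₂ isQuasigroup (y * w) w
  ... | _ , _ , unique = trans (sym (unique eq)) (unique refl)

  ⊙-cancelʳ : ∀ {W X X′} → X ⊙ W ≡ X′ ⊙ W → X ≡ X′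
  ⊙-cancelʳ {W} {X} {X′} eq = lookup-ext λ i →
    *-cancelʳ (trans (sym (lookup-⊙ X W i)) (trans (cong (λ Z → lookup Z i) eq) (lookup-⊙ X′ W i)))

  *ʳ-permutation : Fin n → Permutation′ n
  *ʳ-permutation w = permutation (_* w) (λ c → proj₁ (proj₂ isQuasigroup c w))
    (λ c → proj₁ (proj₂ (proj₂ isQuasigroup c w)))
    (λ b → proj₂ (proj₂ (proj₂ isQuasigroup (b * w) w)) refl)

  []≔-⊙ : ∀ V W j b → (V [ j ]≔ b) ⊙ W ≡ (V ⊙ W) [ j ]≔ (b * lookup W j)
  []≔-⊙ V W j b = lookup-ext lookups
    where
    lookups : ∀ i → lookup ((V [ j ]≔ b) ⊙ W) i ≡ lookup ((V ⊙ W) [ j ]≔ (b * lookup W j)) i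
    lookups i with i ≟ j
    ... | yes refl = begin
      lookup ((V [ i ]≔ b) ⊙ W) i        ≡⟨ lookup-⊙ (V [ i ]≔ b) W i ⟩
      lookup (V [ i ]≔ b) i * lookup W i ≡⟨ cong (_* lookup W i) (lookup∘update i V b) ⟩
      b * lookup W i                     ≡⟨ lookup∘update i (V ⊙ W) _ ⟨
      lookup ((V ⊙ W) [ i ]≔ (b * lookup W i)) i ∎
    ... | no i≢j = begin
      lookup ((V [ j ]≔ b) ⊙ W) i        ≡⟨ lookup-⊙ (V [ j ]≔ b) W i ⟩
      lookup (V [ j ]≔ b) i * lookup W i ≡⟨ cong (_* lookup W i) (lookup∘update′ i≢j V b) ⟩
      lookup V i * lookup W i            ≡⟨ lookup-⊙ V W i ⟨
      lookup (V ⊙ W) i                   ≡⟨ lookup∘update′ i≢j (V ⊙ W) _ ⟨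
      lookup ((V ⊙ W) [ j ]≔ (b * lookup W j)) i ∎

  ⊙-twist : ∀ {i j} (σ : Permutation′ n) V t → i ≢ j → lookup V i * (σ ⟨$⟩ʳ i) ≡ t * (σ ⟨$⟩ʳ j) →
    ∀ m → m ≢ j →
    lookup ((V [ i ]≔ t) ⊙ permutation-tuple (transpose i j ∘ₚ σ)) m ≡ lookup (V ⊙ permutation-tuple σ) m
  ⊙-twist {i} {j} σ V t i≢j balanced m m≢j with m ≟ i
  ... | yes refl = begin
    lookup ((V [ m ]≔ t) ⊙ permutation-tuple (transpose m j ∘ₚ σ)) m
      ≡⟨ lookup-⊙ (V [ m ]≔ t) _ m ⟩
    lookup (V [ m ]≔ t) m * lookup (permutation-tuple (transpose m j ∘ₚ σ)) m
      ≡⟨ cong₂ _*_ (lookup∘update m V t) (trans (lookup∘tabulate _ m) (cong (σ ⟨$⟩ʳ_) (transpose-matchˡ m j))) ⟩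
    t * (σ ⟨$⟩ʳ j)                   ≡⟨ balanced ⟨
    lookup V m * (σ ⟨$⟩ʳ m)          ≡⟨ cong (lookup V m *_) (lookup∘tabulate _ m) ⟨
    lookup V m * lookup (permutation-tuple σ) m ≡⟨ lookup-⊙ V _ m ⟨
    lookup (V ⊙ permutation-tuple σ) m ∎
  ... | no m≢i = begin
    lookup ((V [ i ]≔ t) ⊙ permutation-tuple (transpose i j ∘ₚ σ)) m
      ≡⟨ lookup-⊙ (V [ i ]≔ t) _ m ⟩
    lookup (V [ i ]≔ t) m * lookup (permutation-tuple (transpose i j ∘ₚ σ)) m
      ≡⟨ cong₂ _*_ (lookup∘update′ m≢i V t)
           (trans (lookup∘tabulate _ m) (trans (cong (σ ⟨$⟩ʳ_) (transpose-fixes m≢i m≢j)) (sym (lookup∘tabulate _ m)))) ⟩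
    lookup V m * lookup (permutation-tuple σ) m ≡⟨ lookup-⊙ V _ m ⟨
    lookup (V ⊙ permutation-tuple σ) m ∎

  replicate-⊙ : ∀ d W X → applyDiag _*_ X (replicate d W) ≡ iterate (_⊙ W) X d
  replicate-⊙ zero    W X = refl
  replicate-⊙ (suc d) W X = replicate-⊙ d W (X ⊙ W)

  All-replicate : ∀ d {W : Tuple n} → IsPerm W → All IsPerm (replicate d W)
  All-replicate zero    W-perm = []
  All-replicate (suc d) W-perm = W-perm ∷ All-replicate d W-perm

  Equiv-⊙ : ∀ W → IsPerm W → ∀ X → Equiv _*_ X (X ⊙ W)
  Equiv-⊙ W W-perm X = 1 , W ∷ [] , W-perm ∷ [] , refl

  -- Right multiplication by W is a permutation of the finite set of tuples, so
  -- some power of it undoes one step.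
  Equiv-⊙⁻ : ∀ W → IsPerm W → ∀ X → Equiv _*_ (X ⊙ W) X
  Equiv-⊙⁻ W W-perm X with injective⇒iterate-returns _ tuple-code-injective (_⊙ W) ⊙-cancelʳ X
  ... | d , returns = d , replicate d W , All-replicate d W-perm , trans (replicate-⊙ d W (X ⊙ W)) returns

module Units {n} {_*_ : Op n} (isQuasigroup : IsQuasigroup _*_) {U₀ : Tuple n} {τ}
             {Y : Fin τ → Tuple n → Bool} (isUnits : IsUnits _*_ U₀ τ Y) where

  open Quasigroup isQuasigroup

  ι : Tuple n
  ι = permutation-tuple id

  private
    unit⇒class = proj₁ isUnits
    class⇒unique-unit = proj₁ (proj₂ isUnits)
    unit-nonempty = proj₁ (proj₂ (proj₂ isUnits))
    unit-congruence = proj₂ (proj₂ (proj₂ isUnits))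

  next-unit : ∀ W → IsPerm W → ∀ {k l X} → Y k X ≡ true → Y l (X ⊙ W) ≡ true → Next k l
  next-unit W W-perm {k} {l} {X} X∈k X⊙W∈l =
    next (unit-congruence k l X (X ⊙ W) 1 X∈k X⊙W∈l (proj₂ (Equiv-⊙ W W-perm X)))

  unit-of-⊙ : ∀ W → IsPerm W → ∀ {k X} → Y k X ≡ true → ∃[ l ] Y l (X ⊙ W) ≡ true
  unit-of-⊙ W W-perm {k} {X} X∈k
    with class⇒unique-unit (X ⊙ W) (Equiv-trans (unit⇒class k X X∈k) (Equiv-⊙ W W-perm X))
  ... | l , X⊙W∈l , _ = l , X⊙W∈l

  next-exists : ∀ k → ∃[ l ] Next k l
  next-exists k with unit-nonempty k
  ... | X , X∈k with unit-of-⊙ ι (permutation-tuple-isPerm id) X∈k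
  ... | l , X⊙ι∈l = l , next-unit ι (permutation-tuple-isPerm id) X∈k X⊙ι∈l

  unit-⊙ : ∀ W → IsPerm W → ∀ {k l} → Next k l → ∀ X → Y k X ≡ Y l (X ⊙ W)
  unit-⊙ W W-perm {k} {l} k↝l X = ⇔→≡ (mk⇔ forward backward)
    where
    forward : Y k X ≡ true → Y l (X ⊙ W) ≡ true
    forward X∈k with unit-of-⊙ W W-perm X∈k
    ... | l′ , X⊙W∈l′ = subst (λ u → Y u (X ⊙ W) ≡ true) (Next-functional (next-unit W W-perm X∈k X⊙W∈l′) k↝l) X⊙W∈l′
    backward : Y l (X ⊙ W) ≡ true → Y k X ≡ true
    backward X⊙W∈l with class⇒unique-unit X (Equiv-trans (unit⇒class l (X ⊙ W) X⊙W∈l) (Equiv-⊙⁻ W W-perm X))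
    ... | k′ , X∈k′ , _ = subst (λ u → Y u X ≡ true) (Next-injective (next-unit W W-perm X∈k′ X⊙W∈l) k↝l) X∈k′

  countIn-⊙ : ∀ W → IsPerm W → ∀ {k l} → Next k l → ∀ V j → countIn (Y k) V j ≡ countIn (Y l) (V ⊙ W) j
  countIn-⊙ W W-perm {k} {l} k↝l V j = begin
    countIn (Y k) V j                                        ≡⟨ countIn-as-∑ (Y k) V j ⟩
    ∑[ b < n ] 𝟙 (Y k (V [ j ]≔ b))                          ≡⟨ sum-cong-≗ (λ b → cong 𝟙 (moved b)) ⟩
    ∑[ b < n ] 𝟙 (Y l ((V ⊙ W) [ j ]≔ (b * lookup W j)))     ≡⟨ sum-permute _ (*ʳ-permutation (lookup W j)) ⟨
    ∑[ c < n ] 𝟙 (Y l ((V ⊙ W) [ j ]≔ c))                    ≡⟨ countIn-as-∑ (Y l) (V ⊙ W) j ⟨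
    countIn (Y l) (V ⊙ W) j                                  ∎
    where
    moved : ∀ b → Y k (V [ j ]≔ b) ≡ Y l ((V ⊙ W) [ j ]≔ (b * lookup W j))
    moved b = trans (unit-⊙ W W-perm k↝l (V [ j ]≔ b)) (cong (Y l) ([]≔-⊙ V W j b))

  countIn-[]≔-other : ∀ k V {i j} t → i ≢ j → countIn (Y k) (V [ i ]≔ t) j ≡ countIn (Y k) V j
  countIn-[]≔-other k V {i} {j} t i≢j with next-exists k | proj₁ isQuasigroup (t * j) (lookup V i)
  ... | l , k↝l | a , Vᵢa≡tj , _ with a ≟ j
  ...   | yes refl = cong (λ X → countIn (Y k) X j)
                          (trans (cong (V [ i ]≔_) (sym (*-cancelʳ Vᵢa≡tj))) ([]≔-lookup V i))
  ...   | no a≢j = begin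
    countIn (Y k) (V [ i ]≔ t) j                ≡⟨ countIn-⊙ _ (permutation-tuple-isPerm σ′) k↝l _ j ⟩
    countIn (Y l) ((V [ i ]≔ t) ⊙ permutation-tuple σ′) j ≡⟨ countIn-local (Y l) (⊙-twist σ V t i≢j balanced) ⟩
    countIn (Y l) (V ⊙ permutation-tuple σ) j   ≡⟨ countIn-⊙ _ (permutation-tuple-isPerm σ) k↝l V j ⟨
    countIn (Y k) V j                           ∎
    where
    σ = transpose i a
    σ′ = transpose i j ∘ₚ σ
    balanced : lookup V i * (σ ⟨$⟩ʳ i) ≡ t * (σ ⟨$⟩ʳ j)
    balanced = trans (cong (lookup V i *_) (transpose-matchˡ i a))
                     (trans Vᵢa≡tj (cong (t *_) (sym (transpose-fixes (i≢j ∘ sym) (a≢j ∘ sym)))))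

  countIn-[]≔ : ∀ k V j i t → countIn (Y k) (V [ i ]≔ t) j ≡ countIn (Y k) V j
  countIn-[]≔ k V j i t with i ≟ j
  ... | yes refl = countIn-local (Y k) (λ m m≢i → lookup∘update′ m≢i V t)
  ... | no i≢j   = countIn-[]≔-other k V t i≢j

  countIn-tuple-independent : ∀ k V V′ j → countIn (Y k) V j ≡ countIn (Y k) V′ j
  countIn-tuple-independent k V V′ j =
    update-invariant⇒constant (λ X → countIn (Y k) X j) (λ X i t → countIn-[]≔ k X j i t) V V′

  countIn-next : ∀ {k l} → Next k l → ∀ V j → countIn (Y k) V j ≡ countIn (Y l) V j
  countIn-next k↝l V j = trans (countIn-⊙ ι (permutation-tuple-isPerm id) k↝l V j)
                               (countIn-tuple-independent _ _ V j)

  countIn-fromℕ< : ∀ m (m<τ : m < τ) V j →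
    countIn (Y (fromℕ< m<τ)) V j ≡ countIn (Y (fromℕ< (ℕ.m<n⇒0<n m<τ))) V j
  countIn-fromℕ< zero    m<τ V j = refl
  countIn-fromℕ< (suc m) m<τ V j = begin
    countIn (Y (fromℕ< m<τ)) V j ≡⟨ countIn-next (Next-suc consecutive) V j ⟨
    countIn (Y (fromℕ< m<τ′)) V j ≡⟨ countIn-fromℕ< m m<τ′ V j ⟩
    countIn (Y (fromℕ< (ℕ.m<n⇒0<n m<τ))) V j ∎
    where
    m<τ′ = ℕ.<-trans (ℕ.n<1+n m) m<τ
    consecutive : toℕ (fromℕ< m<τ) ≡ suc (toℕ (fromℕ< m<τ′))
    consecutive = trans (toℕ-fromℕ< m<τ) (cong suc (sym (toℕ-fromℕ< m<τ′)))

  countIn-unit-independent : ∀ k l V j → countIn (Y k) V j ≡ countIn (Y l) V j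
  countIn-unit-independent k l V j = begin
    countIn (Y k) V j                        ≡⟨ cong (λ u → countIn (Y u) V j) (fromℕ<-toℕ k (toℕ<n k)) ⟨
    countIn (Y (fromℕ< (toℕ<n k))) V j       ≡⟨ countIn-fromℕ< (toℕ k) (toℕ<n k) V j ⟩
    countIn (Y (fromℕ< (ℕ.m<n⇒0<n (toℕ<n l)))) V j ≡⟨ countIn-fromℕ< (toℕ l) (toℕ<n l) V j ⟨
    countIn (Y (fromℕ< (toℕ<n l))) V j       ≡⟨ cong (λ u → countIn (Y u) V j) (fromℕ<-toℕ l (toℕ<n l)) ⟩
    countIn (Y l) V j                        ∎

proposition3 : (n : ℕ) (_*_ : Op n) → IsQuasigroup _*_ →
    (U₀ : Tuple n) (τ : ℕ) → IsPeriod _*_ U₀ τ →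
    (Y : Fin τ → Tuple n → Bool) → IsUnits _*_ U₀ τ Y →
    ∃[ r ] (∀ (V : Tuple n) (j : Fin n) (k : Fin τ) → countIn (Y k) V j ≡ r)
proposition3 zero     _ _            _ _        _ _ _       = 0 , λ _ ()
proposition3 (suc n′) _ _            _ zero     _ _ _       = 0 , λ _ _ ()
proposition3 (suc n′) _ isQuasigroup _ (suc τ′) _ Y isUnits =
  countIn (Y zero) V₀ zero , λ V j k → begin
    countIn (Y k) V j       ≡⟨ countIn-unit-independent k zero V j ⟩
    countIn (Y zero) V j    ≡⟨ countIn-tuple-independent zero V V₀ j ⟩
    countIn (Y zero) V₀ j   ≡⟨ countIn-index-independent (Y zero) (countIn-tuple-independent zero) V₀ zero j ⟨
    countIn (Y zero) V₀ zero ∎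
  where
  open Units isQuasigroup isUnits
  V₀ = replicate _ zero
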